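{- Let $T=(V,A)$ be a weighted tournament with weight function $w$ satisfying the probability constraints and the triangle inequality constraints. Let $(L^*,R^*)$ be any (not necessarily colorful) bi-partition of $V$ (i.e. $R^*=V\setminus L^*$). Suppose there exist $x\in L^*$ and $y\in R^*$ such that $\delta(x)\ge\delta(y)$. Then for $\hat L:=(L^*\setminus\{x\})\cup\{y\}$, $\mathrm{cost}(\hat L)\le\mathrm{cost}(L^*)$.
   Context: A weighted tournament $T=(V,A)$ contains, for every pair of distinct vertices $u,v$, both arcs $(u,v)$ and $(v,u)$, with nonnegative weights $w$. Probability constraints: $w(i,j)+w(j,i)=1$ for all distinct $i,j$. Triangle inequality: $w(i,j)\le w(i,k)+w(k,j)$ for all $i,j,k$. The weighted in-degree of $v$ is $\delta(v)=\sum_{u\ne v}w(u,v)$. For $P\subseteq V$, $\mathrm{cost}(P)=\sum_{(y,x)\in A:\,x\in P,\,y\in V\setminus P}w(y,x)$, the total weight of arcs from $V\setminus P$ to $P$.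
   Formalization: The weight function w takes values in ℚ instead of ℝ. -}

module Defs where

open import Data.Nat using (ℕ; zero; suc)
open import Data.Fin using (Fin; zero; suc; _≟_)
open import Data.Fin.Subset using (Subset)
open import Data.Bool using (Bool; true; false; if_then_else_; not)
open import Data.Vec using (lookup)
open import Data.Rational using (ℚ; 0ℚ; _+_)
open import Relation.Nullary.Decidable using (⌊_⌋)

∑ : (n : ℕ) → (Fin n → ℚ) → ℚ
∑ zero    f = 0ℚ
∑ (suc n) f = f zero + ∑ n (λ i → f (suc i))

δ : {n : ℕ} → (Fin n → Fin n → ℚ) → Fin n → ℚ
δ {n} w v = ∑ n (λ u → if ⌊ u ≟ v ⌋ then 0ℚ else w u v)

cost : {n : ℕ} → (Fin n → Fin n → ℚ) → Subset n → ℚ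
cost {n} w P =
  ∑ n (λ x → if lookup P x
               then ∑ n (λ y → if lookup P y then 0ℚ else w y x)
               else 0ℚ)

{-# OPTIONS --safe #-}
-- Exchanging x ∈ L for y ∉ L changes the cost by exactly δ(y) − δ(x), that is
-- cost(L̂) + δ(x) = cost(L) + δ(y), and the claim follows from δ(y) ≤ δ(x).
-- Away from x and y both sides agree vertex by vertex: for a ∈ L the weight entering
-- a from outside trades w(y,a) for w(x,a), and w(x,a) + w(a,x) = 1 = w(y,a) + w(a,y)
-- balances this against the in-degree terms w(a,y) and w(a,x); for a ∉ L those
-- in-degree terms reappear as the weight a sends into x ∈ L and into y ∈ L̂.
module Submission where

open import Defs
open import Data.Nat using (ℕ; zero; suc)
open import Data.Fin using (Fin; zero; suc; _≟_)
open import Relation.Nullary.Decidable using (⌊_⌋)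
open import Data.Fin.Properties using (suc-injective)
open import Data.Fin.Subset using (Subset; _∈_; _∉_; _∪_; _─_; ⁅_⁆)
open import Data.Fin.Subset.Properties
  using (x∈⁅x⁆; x∈⁅y⁆⇒x≡y; x∈p∪q⁺; x∈p∪q⁻; x∈p∧x≢y⇒x∈p-y; p─q⊆p)
open import Data.Bool using (true; false; if_then_else_)
open import Data.Vec using (_∷_; there; lookup)
open import Data.Vec.Properties using ([]=⇒lookup; lookup⇒[]=)
open import Data.Sum using (inj₁; inj₂; [_,_]′)
open import Data.Empty using (⊥-elim)
open import Data.Rational using (ℚ; 0ℚ; 1ℚ; _+_; _-_; _≤_)
open import Data.Rational.Properties
  using (+-assoc; +-comm; +-identityˡ; +-identityʳ; +-monoʳ-≤; +-monoˡ-≤;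
         +-0-group; +-0-commutativeMonoid; module ≤-Reasoning)
open import Data.Rational.Solver using (module +-*-Solver)
open import Algebra.Bundles using (CommutativeMonoid)
open import Algebra.Properties.Group +-0-group using (∙-cancelʳ)
open import Algebra.Properties.CommutativeSemigroup
  (CommutativeMonoid.commutativeSemigroup +-0-commutativeMonoid) using (interchange)
open import Function using (_∘_)
open import Relation.Binary.PropositionalEquality
  using (_≡_; _≢_; refl; sym; trans; cong; cong₂; ≡-≟-identity; ≢-≟-identity;
         module ≡-Reasoning)

open +-*-Solver using (solve; con; _:+_; _:-_; _:=_)

∑-cong : ∀ n {f g : Fin n → ℚ} → (∀ i → f i ≡ g i) → ∑ n f ≡ ∑ n g
∑-cong zero    f≗g = refl
∑-cong (suc n) f≗g = cong₂ _+_ (f≗g zero) (∑-cong n (f≗g ∘ suc))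

∑-distrib-+ : ∀ n (f g : Fin n → ℚ) → ∑ n (λ i → f i + g i) ≡ ∑ n f + ∑ n g
∑-distrib-+ zero    f g = sym (+-identityˡ 0ℚ)
∑-distrib-+ (suc n) f g = begin
  f zero + g zero + ∑ n (λ i → f (suc i) + g (suc i))
    ≡⟨ cong (f zero + g zero +_) (∑-distrib-+ n (f ∘ suc) (g ∘ suc)) ⟩
  f zero + g zero + (∑ n (f ∘ suc) + ∑ n (g ∘ suc))
    ≡⟨ interchange (f zero) (g zero) (∑ n (f ∘ suc)) (∑ n (g ∘ suc)) ⟩
  f zero + ∑ n (f ∘ suc) + (g zero + ∑ n (g ∘ suc)) ∎
  where open ≡-Reasoning

∑-exchange₁ : ∀ n {f g : Fin n → ℚ} x →
              (∀ a → a ≢ x → f a ≡ g a) → ∑ n f + g x ≡ ∑ n g + f x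
∑-exchange₁ (suc n) {f} {g} zero f≗g = begin
  f zero + ∑ n (f ∘ suc) + g zero
    ≡⟨ cong (λ s → f zero + s + g zero) (∑-cong n (λ a → f≗g (suc a) λ ())) ⟩
  f zero + ∑ n (g ∘ suc) + g zero
    ≡⟨ solve 3 (λ a s b → a :+ s :+ b := b :+ s :+ a) refl (f zero) (∑ n (g ∘ suc)) (g zero) ⟩
  g zero + ∑ n (g ∘ suc) + f zero ∎
  where open ≡-Reasoning
∑-exchange₁ (suc n) {f} {g} (suc x) f≗g = begin
  f zero + ∑ n (f ∘ suc) + g (suc x)   ≡⟨ +-assoc (f zero) (∑ n (f ∘ suc)) (g (suc x)) ⟩
  f zero + (∑ n (f ∘ suc) + g (suc x)) ≡⟨ cong₂ _+_ (f≗g zero λ ()) (∑-exchange₁ n x tails-agree) ⟩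
  g zero + (∑ n (g ∘ suc) + f (suc x)) ≡⟨ +-assoc (g zero) (∑ n (g ∘ suc)) (f (suc x)) ⟨
  g zero + ∑ n (g ∘ suc) + f (suc x)   ∎
  where
  open ≡-Reasoning
  tails-agree : ∀ a → a ≢ x → f (suc a) ≡ g (suc a)
  tails-agree a a≢x = f≗g (suc a) (a≢x ∘ suc-injective)

∑-exchange₂ : ∀ n {f g : Fin n → ℚ} {x y} → x ≢ y →
              (∀ a → a ≢ x → a ≢ y → f a ≡ g a) →
              ∑ n f + (g x + g y) ≡ ∑ n g + (f x + f y)
∑-exchange₂ (suc n) {x = zero} {zero} x≢y f≗g = ⊥-elim (x≢y refl)
∑-exchange₂ (suc n) {f} {g} {zero} {suc y} x≢y f≗g = begin
  f zero + ∑ n (f ∘ suc) + (g zero + g (suc y))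
    ≡⟨ interchange (f zero) (∑ n (f ∘ suc)) (g zero) (g (suc y)) ⟩
  f zero + g zero + (∑ n (f ∘ suc) + g (suc y))
    ≡⟨ cong₂ _+_ (+-comm (f zero) (g zero)) (∑-exchange₁ n y tails-agree) ⟩
  g zero + f zero + (∑ n (g ∘ suc) + f (suc y))
    ≡⟨ interchange (g zero) (∑ n (g ∘ suc)) (f zero) (f (suc y)) ⟨
  g zero + ∑ n (g ∘ suc) + (f zero + f (suc y)) ∎
  where
  open ≡-Reasoning
  tails-agree : ∀ a → a ≢ y → f (suc a) ≡ g (suc a)
  tails-agree a a≢y = f≗g (suc a) (λ ()) (a≢y ∘ suc-injective)
∑-exchange₂ (suc n) {f} {g} {suc x} {zero} x≢y f≗g = begin
  f zero + ∑ n (f ∘ suc) + (g (suc x) + g zero)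
    ≡⟨ cong (f zero + ∑ n (f ∘ suc) +_) (+-comm (g (suc x)) (g zero)) ⟩
  f zero + ∑ n (f ∘ suc) + (g zero + g (suc x))
    ≡⟨ interchange (f zero) (∑ n (f ∘ suc)) (g zero) (g (suc x)) ⟩
  f zero + g zero + (∑ n (f ∘ suc) + g (suc x))
    ≡⟨ cong₂ _+_ (+-comm (f zero) (g zero)) (∑-exchange₁ n x tails-agree) ⟩
  g zero + f zero + (∑ n (g ∘ suc) + f (suc x))
    ≡⟨ interchange (g zero) (∑ n (g ∘ suc)) (f zero) (f (suc x)) ⟨
  g zero + ∑ n (g ∘ suc) + (f zero + f (suc x))
    ≡⟨ cong (g zero + ∑ n (g ∘ suc) +_) (+-comm (f zero) (f (suc x))) ⟩
  g zero + ∑ n (g ∘ suc) + (f (suc x) + f zero) ∎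
  where
  open ≡-Reasoning
  tails-agree : ∀ a → a ≢ x → f (suc a) ≡ g (suc a)
  tails-agree a a≢x = f≗g (suc a) (a≢x ∘ suc-injective) (λ ())
∑-exchange₂ (suc n) {f} {g} {suc x} {suc y} x≢y f≗g = begin
  f zero + ∑ n (f ∘ suc) + (g (suc x) + g (suc y))   ≡⟨ +-assoc (f zero) (∑ n (f ∘ suc)) _ ⟩
  f zero + (∑ n (f ∘ suc) + (g (suc x) + g (suc y)))
    ≡⟨ cong₂ _+_ (f≗g zero (λ ()) (λ ())) (∑-exchange₂ n (x≢y ∘ cong suc) tails-agree) ⟩
  g zero + (∑ n (g ∘ suc) + (f (suc x) + f (suc y))) ≡⟨ +-assoc (g zero) (∑ n (g ∘ suc)) _ ⟨
  g zero + ∑ n (g ∘ suc) + (f (suc x) + f (suc y))   ∎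
  where
  open ≡-Reasoning
  tails-agree : ∀ a → a ≢ x → a ≢ y → f (suc a) ≡ g (suc a)
  tails-agree a a≢x a≢y = f≗g (suc a) (a≢x ∘ suc-injective) (a≢y ∘ suc-injective)

complement-transfer : ∀ {a b p q p′ q′ : ℚ} →
                      a + p ≡ b + q → p + p′ ≡ q + q′ → a + q′ ≡ b + p′
complement-transfer {a} {b} {p} {q} {p′} {q′} balance complements = begin
  a + q′
    ≡⟨ solve 4 (λ a p q q′ → a :+ q′ := a :+ p :+ (q :+ q′) :- (p :+ q)) refl a p q q′ ⟩
  a + p + (q + q′) - (p + q)
    ≡⟨ cong (_- (p + q)) (cong₂ _+_ balance (sym complements)) ⟩
  b + q + (p + p′) - (p + q)
    ≡⟨ solve 4 (λ b p q p′ → b :+ q :+ (p :+ p′) :- (p :+ q) := b :+ p′) refl b p q p′ ⟩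
  b + p′ ∎
  where open ≡-Reasoning

balance⇒≤ : ∀ {a b d e : ℚ} → a + d ≡ b + e → e ≤ d → a ≤ b
balance⇒≤ {a} {b} {d} {e} balance e≤d = begin
  a              ≡⟨ solve 2 (λ a d → a := a :+ d :- d) refl a d ⟩
  a + d - d      ≡⟨ cong (_- d) balance ⟩
  b + e - d      ≤⟨ +-monoˡ-≤ _ (+-monoʳ-≤ b e≤d) ⟩
  b + d - d      ≡⟨ solve 2 (λ b d → b :+ d :- d := b) refl b d ⟩
  b              ∎
  where open ≤-Reasoning

∉⇒lookup≡false : ∀ {n} {p : Subset n} {a} → a ∉ p → lookup p a ≡ false
∉⇒lookup≡false {p = p} {a} a∉p with lookup p a in eq
... | true  = ⊥-elim (a∉p (lookup⇒[]= a p eq))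
... | false = refl

lookup-cong-∈ : ∀ {n} {p q : Subset n} {a} →
                (a ∈ p → a ∈ q) → (a ∈ q → a ∈ p) → lookup p a ≡ lookup q a
lookup-cong-∈ {p = p} {q} {a} p⇒q q⇒p with lookup p a in eqp | lookup q a in eqq
... | true  | true  = refl
... | false | false = refl
... | true  | false = trans (sym ([]=⇒lookup (p⇒q (lookup⇒[]= a p eqp)))) eqq
... | false | true  = sym (trans (sym ([]=⇒lookup (q⇒p (lookup⇒[]= a q eqq)))) eqp)

x∉p-x : ∀ {n} {p : Subset n} x → x ∉ p ─ ⁅ x ⁆
x∉p-x {p = _ ∷ _} zero    ()
x∉p-x {p = _ ∷ _} (suc x) (there x∈p-x) = x∉p-x x x∈p-x

record Exchange {n} (P Q : Subset n) (x y : Fin n) : Set where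
  field
    x∈P    : lookup P x ≡ true
    y∉P    : lookup P y ≡ false
    x∉Q    : lookup Q x ≡ false
    y∈Q    : lookup Q y ≡ true
    agrees : ∀ a → a ≢ x → a ≢ y → lookup P a ≡ lookup Q a

  x≢y : x ≢ y
  x≢y refl with () ← trans (sym x∈P) y∉P

  reverse : Exchange Q P y x
  reverse = record
    { x∈P = y∈Q ; y∉P = x∉Q ; x∉Q = y∉P ; y∈Q = x∈P
    ; agrees = λ a a≢y a≢x → sym (agrees a a≢x a≢y) }

exchange : ∀ {n} {P : Subset n} {x y} → x ∈ P → y ∉ P → Exchange P ((P ─ ⁅ x ⁆) ∪ ⁅ y ⁆) x y
exchange {P = P} {x} {y} x∈P y∉P = record
  { x∈P    = []=⇒lookup x∈P
  ; y∉P    = ∉⇒lookup≡false y∉P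
  ; x∉Q    = ∉⇒lookup≡false ([ x∉p-x x , x≢y ∘ x∈⁅y⁆⇒x≡y y ]′ ∘ x∈p∪q⁻ (P ─ ⁅ x ⁆) ⁅ y ⁆)
  ; y∈Q    = []=⇒lookup (x∈p∪q⁺ {p = P ─ ⁅ x ⁆} (inj₂ (x∈⁅x⁆ y)))
  ; agrees = λ a a≢x a≢y → lookup-cong-∈
      (λ a∈P → x∈p∪q⁺ (inj₁ (x∈p∧x≢y⇒x∈p-y a∈P a≢x)))
      ([ p─q⊆p P ⁅ x ⁆ , ⊥-elim ∘ a≢y ∘ x∈⁅y⁆⇒x≡y y ]′ ∘ x∈p∪q⁻ (P ─ ⁅ x ⁆) ⁅ y ⁆)
  }
  where
  x≢y : x ≢ y
  x≢y refl = y∉P x∈P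

module _ {n : ℕ} (w : Fin n → Fin n → ℚ) where

  Complementary : Set
  Complementary = ∀ i j → i ≢ j → w i j + w j i ≡ 1ℚ

  inflowTerm : Subset n → Fin n → Fin n → ℚ
  inflowTerm P v b = if lookup P b then 0ℚ else w b v

  inflow : Subset n → Fin n → ℚ
  inflow P v = ∑ n (inflowTerm P v)

  inflowTerm-lookup : ∀ P v b {s} → lookup P b ≡ s → inflowTerm P v b ≡ (if s then 0ℚ else w b v)
  inflowTerm-lookup P v b = cong (λ s → if s then 0ℚ else w b v)

  -- cost w P and δ w v unfold definitionally to ∑ n (costTerm P) and ∑ n (δTerm v).
  costTerm : Subset n → Fin n → ℚ
  costTerm P a = if lookup P a then inflow P a else 0ℚ

  δTerm : Fin n → Fin n → ℚ
  δTerm v u = if ⌊ u ≟ v ⌋ then 0ℚ else w u v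

  -- The inflowTerm P x summand is what makes exchangeTerm P x y agree with
  -- exchangeTerm Q y x away from x and y.
  exchangeTerm : Subset n → Fin n → Fin n → Fin n → ℚ
  exchangeTerm P x y a = costTerm P a + δTerm y a + inflowTerm P x a

  ∑-exchangeTerm : ∀ P x y → ∑ n (exchangeTerm P x y) ≡ cost w P + δ w y + inflow P x
  ∑-exchangeTerm P x y = trans (∑-distrib-+ n _ (inflowTerm P x))
                               (cong (_+ inflow P x) (∑-distrib-+ n (costTerm P) (δTerm y)))

  module _ {P Q : Subset n} {x y : Fin n} (ex : Exchange P Q x y) where
    open Exchange ex

    exchangeTerm-x : exchangeTerm P x y x ≡ inflow P x + w x y
    exchangeTerm-x rewrite x∈P | ≢-≟-identity _≟_ x≢y = +-identityʳ _

    exchangeTerm-y : exchangeTerm P x y y ≡ w y x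
    exchangeTerm-y rewrite y∉P | ≡-≟-identity _≟_ {y} refl =
      trans (cong (_+ w y x) (+-identityˡ 0ℚ)) (+-identityˡ (w y x))

    inflow-exchange : ∀ a → inflow P a + w x a ≡ inflow Q a + w y a
    inflow-exchange a = begin
      inflow P a + w x a
        ≡⟨ cong (inflow P a +_) (+-identityʳ (w x a)) ⟨
      inflow P a + (w x a + 0ℚ)
        ≡⟨ cong (inflow P a +_) (cong₂ _+_ (inflowTerm-lookup Q a x x∉Q) (inflowTerm-lookup Q a y y∈Q)) ⟨
      inflow P a + (inflowTerm Q a x + inflowTerm Q a y)
        ≡⟨ ∑-exchange₂ n x≢y (λ b b≢x b≢y → inflowTerm-lookup P a b (agrees b b≢x b≢y)) ⟩
      inflow Q a + (inflowTerm P a x + inflowTerm P a y)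
        ≡⟨ cong (inflow Q a +_) (cong₂ _+_ (inflowTerm-lookup P a x x∈P) (inflowTerm-lookup P a y y∉P)) ⟩
      inflow Q a + (0ℚ + w y a)
        ≡⟨ cong (inflow Q a +_) (+-identityˡ (w y a)) ⟩
      inflow Q a + w y a ∎
      where open ≡-Reasoning

    exchangeTerm-agrees : Complementary → ∀ a → a ≢ x → a ≢ y →
                          exchangeTerm P x y a ≡ exchangeTerm Q y x a
    exchangeTerm-agrees complementary a a≢x a≢y
      rewrite agrees a a≢x a≢y | ≢-≟-identity _≟_ a≢x | ≢-≟-identity _≟_ a≢y
      with lookup Q a
    ... | true  = cong (_+ 0ℚ) (complement-transfer {inflow P a} {inflow Q a} {w x a} {w y a}
                                                   (inflow-exchange a) complements)
      where
      complements : w x a + w a x ≡ w y a + w a y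
      complements = trans (complementary x a (a≢x ∘ sym)) (sym (complementary y a (a≢y ∘ sym)))
    ... | false = solve 2 (λ p q → con 0ℚ :+ p :+ q := con 0ℚ :+ q :+ p) refl (w a y) (w a x)

  cost-exchange : Complementary → ∀ {P Q x y} → Exchange P Q x y →
                  cost w Q + δ w x ≡ cost w P + δ w y
  cost-exchange complementary {P} {Q} {x} {y} ex =
    ∙-cancelʳ K (cost w Q + δ w x) (cost w P + δ w y) (begin
      cost w Q + δ w x + K
        ≡⟨ solve 5 (λ A p q r s → A :+ (p :+ q :+ r :+ s) := A :+ q :+ (p :+ r :+ s)) refl
                   (cost w Q + δ w x) (inflow P x) (inflow Q y) (w x y) (w y x) ⟩
      cost w Q + δ w x + inflow Q y + (inflow P x + w x y + w y x)
        ≡⟨ cong₂ _+_ (∑-exchangeTerm Q y x) (cong₂ _+_ (exchangeTerm-x ex) (exchangeTerm-y ex)) ⟨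
      ∑ n (exchangeTerm Q y x) + (exchangeTerm P x y x + exchangeTerm P x y y)
        ≡⟨ ∑-exchange₂ n x≢y (exchangeTerm-agrees ex complementary) ⟨
      ∑ n (exchangeTerm P x y) + (exchangeTerm Q y x x + exchangeTerm Q y x y)
        ≡⟨ cong₂ _+_ (∑-exchangeTerm P x y) (cong₂ _+_ (exchangeTerm-y reverse) (exchangeTerm-x reverse)) ⟩
      cost w P + δ w y + inflow P x + (w x y + (inflow Q y + w y x))
        ≡⟨ solve 5 (λ A p q r s → A :+ p :+ (r :+ (q :+ s)) := A :+ (p :+ q :+ r :+ s)) refl
                   (cost w P + δ w y) (inflow P x) (inflow Q y) (w x y) (w y x) ⟩
      cost w P + δ w y + K ∎)
    where
    open ≡-Reasoning
    open Exchange ex using (x≢y; reverse)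
    K : ℚ
    K = inflow P x + inflow Q y + w x y + w y x

lemma1 : (n : ℕ) (w : Fin n → Fin n → ℚ) →
         (∀ i j → i ≢ j → 0ℚ ≤ w i j) →
         (∀ i j → i ≢ j → w i j + w j i ≡ 1ℚ) →
         (∀ i j k → i ≢ j → j ≢ k → i ≢ k → w i j ≤ w i k + w k j) →
         (L : Subset n) (x y : Fin n) → x ∈ L → y ∉ L →
         δ w y ≤ δ w x →
         cost w ((L ─ ⁅ x ⁆) ∪ ⁅ y ⁆) ≤ cost w L
lemma1 n w _ complementary _ L x y x∈L y∉L δy≤δx =
  balance⇒≤ (cost-exchange w complementary (exchange x∈L y∉L)) δy≤δx
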